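{- For every integer $n\geq 7$, the Fibonacci-sum graph $G_n$ has treewidth $2$.
   Context: The Fibonacci numbers are defined by $F_0=0$, $F_1=1$ and $F_m=F_{m-1}+F_{m-2}$ for $m\geq 2$. For each integer $n\geq 1$, the Fibonacci-sum graph $G_n$ is the simple graph with vertex set $\{1,2,\dots,n\}$ in which distinct vertices $i,j$ are adjacent if and only if $i+j$ is a Fibonacci number. -}

module Defs where

open import Level using (0ℓ)
open import Data.Nat using (ℕ; zero; suc; _+_; _≤_; _<_)
open import Data.Fin using (Fin; toℕ)
open import Data.Fin.Subset using (Subset; _∈_; ∣_∣)
open import Data.List using (List; length; _++_; take)
open import Data.List.Relation.Unary.Linked using (Linked)
open import Data.List.Relation.Unary.Unique.Propositional using (Unique)
open import Data.Product using (Σ; ∃; _×_)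
open import Relation.Binary.PropositionalEquality using (_≡_; _≢_)
open import Relation.Binary.Construct.Closure.ReflexiveTransitive using (Star)
open import Relation.Nullary using (¬_)

fib : ℕ → ℕ
fib zero = 0
fib (suc zero) = 1
fib (suc (suc m)) = fib (suc m) + fib m

IsFib : ℕ → Set
IsFib k = ∃ λ m → fib m ≡ k

record Graph : Set₁ where
  field
    n     : ℕ
    Adj   : Fin n → Fin n → Set
    sym   : ∀ {u v} → Adj u v → Adj v u
    irrefl : ∀ {v} → ¬ Adj v v
open Graph public

-- Fibonacci-sum graph G_n: Fin n element i stands for the integer i+1
FibAdj : (n : ℕ) → Fin n → Fin n → Set
FibAdj n i j = i ≢ j × IsFib (suc (toℕ i) + suc (toℕ j))

fibSumGraph : ℕ → Graph
fibSumGraph n = record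
  { n = n
  ; Adj = FibAdj n
  ; sym = λ { {u} {v} (ne , (m , eq)) → (λ e → ne (Relation.Binary.PropositionalEquality.sym e))
            , (m , Relation.Binary.PropositionalEquality.trans eq (Data.Nat.Properties.+-comm (suc (toℕ u)) (suc (toℕ v)))) }
  ; irrefl = λ { (ne , _) → ne Relation.Binary.PropositionalEquality.refl }
  }
  where
  open import Data.Product using (_,_)
  import Data.Nat.Properties

IsCycle : {m : ℕ} → (Fin m → Fin m → Set) → List (Fin m) → Set
IsCycle E cs = 3 ≤ length cs × Unique cs × Linked E (cs ++ take 1 cs)

record Tree : Set₁ where
  field
    m         : ℕ
    E         : Fin m → Fin m → Set
    E-sym     : ∀ {a b} → E a b → E b a
    E-irrefl  : ∀ {a} → ¬ E a a
    connected : ∀ a b → Star E a b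
    acyclic   : ∀ cs → ¬ IsCycle E cs
open Tree public

record TreeDecomposition (G : Graph) : Set₁ where
  field
    tree     : Tree
    bag      : Fin (m tree) → Subset (n G)
    covers   : ∀ v → ∃ λ t → v ∈ bag t
    edges    : ∀ u v → Adj G u v → ∃ λ t → u ∈ bag t × v ∈ bag t
    coherent : ∀ v t t' → v ∈ bag t → v ∈ bag t' →
               Star (λ a b → E tree a b × v ∈ bag a × v ∈ bag b) t t'
open TreeDecomposition public

WidthAtMost : {G : Graph} → TreeDecomposition G → ℕ → Set
WidthAtMost D k = ∀ t → ∣ bag D t ∣ ≤ suc k

HasTreeDecompositionOfWidth≤ : Graph → ℕ → Set₁
HasTreeDecompositionOfWidth≤ G k = Σ (TreeDecomposition G) λ D → WidthAtMost D k

Treewidth : Graph → ℕ → Set₁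
Treewidth G k = HasTreeDecompositionOfWidth≤ G k
              × (∀ j → j < k → ¬ HasTreeDecompositionOfWidth≤ G j)

module Submission where

-- Every w ≥ 1 lies in a unique Fibonacci interval F_{j+1} ≤ w < F_{j+2};
-- write a = w − F_{j+1} and b = F_{j+2} − w, so a + b = F_j.  A smaller neighbour u of w
-- has u + w ∈ {F_{j+2}, F_{j+3}}, i.e. u = b or u = F_{j+1} + b.  We attach to w two
-- numbers, its parent p(w) and a second vertex s(w):  (p, s) = (b, a) if a ≤ b and
-- (F_{j+1} + b, b) otherwise.  Then (E) every smaller neighbour of w is p(w) or s(w),
-- (P) 1 ≤ p(w) < w for w ≥ 2, and (C) s(w) ∈ {p(w), p(p(w)), s(p(w))}.  By (P) the
-- parent map makes the vertices a tree rooted at 1 (a general fact about parent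
-- functions, proved for any N and P), and the bags {w, p(w), s(w)} form a tree
-- decomposition of width 2: (E) gives the edge condition and (C) shows that a vertex
-- in the bag of t stays in every bag on the way from t up to that vertex.
--
-- Lower bound.  1 – 2 – 6 – 7 – 1 is a 4-cycle of G_n for n ≥ 7 (sums 3, 8, 13, 8), and a
-- tree decomposition with bags of size ≤ 2 cannot host a 4-cycle: the subtrees of its
-- vertices would yield a walk around a tree edge that avoids that edge.

open import Defs hiding (sym)

open import Data.Bool using (true; false)
open import Data.Empty using (⊥; ⊥-elim)
open import Data.Fin using (Fin; toℕ; fromℕ<; #_)
open import Data.Fin.Properties using (toℕ<n; toℕ-fromℕ<; toℕ-injective) renaming (_≟_ to _≟ᶠ_)
open import Data.Fin.Subset using (Subset; _∈_; _∉_; ∣_∣; _∪_; _-_)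
open import Data.Fin.Subset.Properties
  using (x∈p∪q⁻; x∈p∪q⁺; _∈?_; x∈p⇒∣p-x∣<∣p∣; x∈p∧x≢y⇒x∈p-y)
open import Data.List using (List; []; _∷_; _++_)
open import Data.List.Membership.Propositional using () renaming (_∈_ to _∈ˡ_)
open import Data.List.Relation.Unary.All using (All; []; _∷_)
import Data.List.Relation.Unary.All as All
open import Data.List.Relation.Unary.All.Properties.Core using (¬Any⇒All¬)
open import Data.List.Relation.Unary.AllPairs using ([]; _∷_)
open import Data.List.Relation.Unary.AllPairs.Properties using (++⁺)
open import Data.List.Relation.Unary.Any using (here; there; any?)
open import Data.List.Relation.Unary.Linked using (Linked; []; [-]; _∷_)
import Data.List.Relation.Unary.Linked as Linked
open import Data.List.Relation.Unary.Unique.Propositional using (Unique)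
open import Data.Nat
  using ( ℕ; zero; suc; _+_; _∸_; pred; _≤_; _<_; _≤′_; ≤′-refl; ≤′-step; z≤n; s≤s
        ; >-nonZero; _≟_; _<?_; _≤?_ )
open import Data.Nat.Properties
open import Data.Product using (∃; _×_; _,_; proj₁; proj₂)
open import Data.Sum using (_⊎_; inj₁; inj₂)
open import Data.Vec using ([]; _∷_; here; there)
open import Function using (_∘_)
open import Relation.Binary.Construct.Closure.ReflexiveTransitive using (Star; ε; _◅_; _◅◅_)
import Relation.Binary.Construct.Closure.ReflexiveTransitive as Star
open import Relation.Binary.Definitions using (DecidableEquality; tri<; tri≈; tri>)
open import Relation.Binary.PropositionalEquality
  using (_≡_; _≢_; refl; sym; trans; cong; subst; subst₂; module ≡-Reasoning)
open import Relation.Nullary using (¬_; Dec; yes; no)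

open ≡-Reasoning

fib-pos : ∀ k → 1 ≤ fib (suc k)
fib-pos zero    = ≤-refl
fib-pos (suc k) = ≤-trans (fib-pos k) (m≤m+n _ _)

fib-step : ∀ k → fib k ≤ fib (suc k)
fib-step zero    = z≤n
fib-step (suc k) = m≤m+n _ _

fib-mono : ∀ {a b} → a ≤ b → fib a ≤ fib b
fib-mono = go ∘ ≤⇒≤′
  where
  go : ∀ {a b} → a ≤′ b → fib a ≤ fib b
  go ≤′-refl                     = ≤-refl
  go {b = suc b} (≤′-step a≤b) = ≤-trans (go a≤b) (fib-step b)

fib-strict : ∀ k → 2 ≤ k → fib k < fib (suc k)
fib-strict (suc zero)    (s≤s ())
fib-strict (suc (suc j)) _ = m<m+n (fib (suc (suc j))) (fib-pos j)

record Bracket (j w : ℕ) : Set where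
  constructor bracket
  field
    lower : fib (suc j) ≤ w
    upper : w < fib (suc (suc j))
open Bracket

levelStep : ℕ → ℕ → ℕ
levelStep w j with w <? fib (suc (suc j))
... | yes _ = j
... | no  _ = suc j

level : ℕ → ℕ
level zero          = 0
level (suc zero)    = 1
level (suc (suc w)) = levelStep (suc (suc w)) (level (suc w))

levelStep-bracket : ∀ {j w} → Bracket j w → Bracket (levelStep (suc w) j) (suc w)
levelStep-bracket {j} {w} (bracket lo hi) with suc w <? fib (suc (suc j))
... | yes w<F = bracket (m≤n⇒m≤1+n lo) w<F
... | no  w≮F = bracket (≮⇒≥ w≮F) (≤-<-trans hi (m<m+n _ (fib-pos j)))

level-bracket : ∀ w → 1 ≤ w → Bracket (level w) w
level-bracket (suc zero)    _ = bracket ≤-refl (s≤s (s≤s z≤n))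
level-bracket (suc (suc w)) _ = levelStep-bracket (level-bracket (suc w) (s≤s z≤n))

bracket-unique : ∀ {j j′ w} → Bracket j w → Bracket j′ w → j ≡ j′
bracket-unique {j} {j′} (bracket lo hi) (bracket lo′ hi′) with <-cmp j j′
... | tri≈ _ j≡j′ _ = j≡j′
... | tri< j<j′ _ _ = ⊥-elim (<⇒≱ hi (≤-trans (fib-mono (s≤s j<j′)) lo′))
... | tri> _ _ j>j′ = ⊥-elim (<⇒≱ hi′ (≤-trans (fib-mono (s≤s j>j′)) lo))

level-unique : ∀ {j w} → Bracket j w → level w ≡ j
level-unique {j} br = bracket-unique (level-bracket _ (≤-trans (fib-pos j) (lower br))) br

-- Integers w ≥ 2 lie at level ≥ 2, where the Fibonacci numbers start to grow strictly.
bracket-index : ∀ {j w} → 2 ≤ w → Bracket j w → 2 ≤ j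
bracket-index {zero}        2≤w br = ⊥-elim (<⇒≱ (upper br) (≤-trans (s≤s z≤n) 2≤w))
bracket-index {suc zero}    2≤w br = ⊥-elim (<⇒≱ (upper br) 2≤w)
bracket-index {suc (suc j)} _   _  = s≤s (s≤s z≤n)

excess deficit : ℕ → ℕ → ℕ
excess  j w = w ∸ fib (suc j)
deficit j w = fib (suc (suc j)) ∸ w

module _ {j w : ℕ} (br : Bracket j w) where

  excess-eq : fib (suc j) + excess j w ≡ w
  excess-eq = m+[n∸m]≡n (lower br)

  deficit-eq : w + deficit j w ≡ fib (suc (suc j))
  deficit-eq = m+[n∸m]≡n (<⇒≤ (upper br))

  deficit-pos : 1 ≤ deficit j w
  deficit-pos = m<n⇒0<n∸m (upper br)

  gap-eq : excess j w + deficit j w ≡ fib j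
  gap-eq = +-cancelˡ-≡ (fib (suc j)) _ _ (begin
    fib (suc j) + (excess j w + deficit j w) ≡⟨ sym (+-assoc (fib (suc j)) _ _) ⟩
    fib (suc j) + excess j w + deficit j w   ≡⟨ cong (_+ deficit j w) excess-eq ⟩
    w + deficit j w                          ≡⟨ deficit-eq ⟩
    fib (suc j) + fib j                      ∎)

  sum-to-F₂ : ∀ {u} → u + w ≡ fib (suc (suc j)) → u ≡ deficit j w
  sum-to-F₂ {u} eq = +-cancelʳ-≡ w u (deficit j w)
    (trans eq (trans (sym deficit-eq) (+-comm w (deficit j w))))

  sum-to-F₃ : ∀ {u} → u + w ≡ fib (suc (suc (suc j))) → u ≡ fib (suc j) + deficit j w
  sum-to-F₃ {u} eq = +-cancelʳ-≡ w u (fib (suc j) + deficit j w) (begin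
    u + w                             ≡⟨ eq ⟩
    fib (suc (suc j)) + fib (suc j)   ≡⟨ cong (_+ fib (suc j)) (sym deficit-eq) ⟩
    w + deficit j w + fib (suc j)     ≡⟨ +-assoc w _ _ ⟩
    w + (deficit j w + fib (suc j))   ≡⟨ +-comm w _ ⟩
    deficit j w + fib (suc j) + w     ≡⟨ cong (_+ w) (+-comm (deficit j w) _) ⟩
    fib (suc j) + deficit j w + w     ∎)

  -- A Fibonacci sum u + w with 0 < u < w is F_{j+2} or F_{j+3}: it exceeds w ≥ F_{j+1}
  -- and is below 2·F_{j+2} ≤ F_{j+4}.
  sum-index : ∀ {u m} → 1 ≤ u → u < w → u + w ≡ fib m →
              m ≡ suc (suc j) ⊎ m ≡ suc (suc (suc j))
  sum-index {u} {m} 1≤u u<w eq with <-cmp m (suc (suc j))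
  ... | tri≈ _ m≡ _ = inj₁ m≡
  ... | tri< m<j+2 _ _ =
    ⊥-elim (<⇒≱ (subst (w <_) eq (m<n+m w 1≤u)) (≤-trans (fib-mono (≤-pred m<j+2)) (lower br)))
  ... | tri> _ _ m>j+2 with m ≟ suc (suc (suc j))
  ...   | yes m≡ = inj₂ m≡
  ...   | no  m≢ = ⊥-elim (<⇒≱ (subst (_< F₂ + F₂) eq (+-mono-< (<-trans u<w (upper br)) (upper br)))
                                (≤-trans (+-monoˡ-≤ F₂ (m≤m+n F₂ (fib (suc j))))
                                         (fib-mono (≤∧≢⇒< m>j+2 (m≢ ∘ sym)))))
    where
    F₂ : ℕ
    F₂ = fib (suc (suc j))

data Shape (F a b : ℕ) : ℕ × ℕ → Set where
  low  : a ≤ b → Shape F a b (b , a)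
  high : b < a → Shape F a b (F + b , b)

choose : ℕ → ℕ → ℕ × ℕ
choose j w with excess j w ≤? deficit j w
... | yes _ = deficit j w , excess j w
... | no  _ = fib (suc j) + deficit j w , deficit j w

shape : ∀ j w → Shape (fib (suc j)) (excess j w) (deficit j w) (choose j w)
shape j w with excess j w ≤? deficit j w
... | yes a≤b = low a≤b
... | no  a≰b = high (≰⇒> a≰b)

low-second : ∀ {F a b pair} → Shape F a b pair → a ≤ b → proj₂ pair ≡ a
low-second (low _)    _   = refl
low-second (high b<a) a≤b = ⊥-elim (<⇒≱ b<a a≤b)

parent second : ℕ → ℕ
parent w = proj₁ (choose (level w) w)
second w = proj₂ (choose (level w) w)

-- (E) at a given level: b is hit by the sum F_{j+2}, F_{j+1} + b by F_{j+3}; the latter is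
-- below w only when b < a.
neighbour-at : ∀ {j w u m} → Bracket j w → 1 ≤ u → u < w → u + w ≡ fib m →
               u ≡ proj₁ (choose j w) ⊎ u ≡ proj₂ (choose j w)
neighbour-at {j} {w} {u} {m} br 1≤u u<w eq with choose j w | shape j w | sum-index br {u} {m} 1≤u u<w eq
... | _ | low  _   | inj₁ refl = inj₁ (sum-to-F₂ br eq)
... | _ | high _   | inj₁ refl = inj₂ (sum-to-F₂ br eq)
... | _ | high _   | inj₂ refl = inj₁ (sum-to-F₃ br eq)
... | _ | low  a≤b | inj₂ refl = ⊥-elim (<⇒≱ deficit<excess a≤b)
  where
  deficit<excess : deficit j w < excess j w
  deficit<excess = +-cancelˡ-< (fib (suc j)) _ _
    (subst₂ _<_ (sum-to-F₃ br eq) (sym (excess-eq br)) u<w)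

neighbour : ∀ {u w} m → 1 ≤ u → u < w → u + w ≡ fib m → u ≡ parent w ⊎ u ≡ second w
neighbour {w = w} m 1≤u u<w = neighbour-at {m = m} (level-bracket w (≤-trans 1≤u (<⇒≤ u<w))) 1≤u u<w

-- (P) at a given level: b ≤ F_j < F_{j+1} ≤ w, resp. F_{j+1} + b < F_{j+1} + a = w.
parent-at-below : ∀ {j w} → Bracket j w → 2 ≤ j →
                  1 ≤ proj₁ (choose j w) × proj₁ (choose j w) < w
parent-at-below {j} {w} br 2≤j with choose j w | shape j w
... | _ | low _ = deficit-pos br ,
  <-≤-trans (≤-<-trans (subst (deficit j w ≤_) (gap-eq br) (m≤n+m _ _)) (fib-strict j 2≤j)) (lower br)
... | _ | high b<a = ≤-trans (deficit-pos br) (m≤n+m _ _) ,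
  subst (fib (suc j) + deficit j w <_) (excess-eq br) (+-monoʳ-< (fib (suc j)) b<a)

parent-below : ∀ w → 2 ≤ w → 1 ≤ parent w × parent w < w
parent-below w 2≤w = parent-at-below br (bracket-index 2≤w br)
  where br = level-bracket w (≤-trans (s≤s z≤n) 2≤w)

-- When b < a, the parent p = F_{j+1} + b lies in the same interval with excess b and
-- deficit a, so it falls in the first case and its second vertex is again b.
parent-swaps : ∀ {j w} → Bracket j w → deficit j w < excess j w →
               second (fib (suc j) + deficit j w) ≡ deficit j w
parent-swaps {j} {w} br b<a = begin
  second p            ≡⟨ cong (λ k → proj₂ (choose k p)) (level-unique br′) ⟩
  proj₂ (choose j p)  ≡⟨ low-second (shape j p) (subst₂ _≤_ (sym excess′) (sym deficit′) (<⇒≤ b<a)) ⟩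
  excess j p          ≡⟨ excess′ ⟩
  deficit j w         ∎
  where
  a b p : ℕ
  a = excess j w
  b = deficit j w
  p = fib (suc j) + b
  br′ : Bracket j p
  br′ = bracket (m≤m+n _ _)
    (+-monoʳ-< (fib (suc j)) (subst (b <_) (gap-eq br) (m<n+m b (≤-<-trans z≤n b<a))))
  excess′ : excess j p ≡ b
  excess′ = m+n∸m≡n (fib (suc j)) b
  p+a≡F : p + a ≡ fib (suc (suc j))
  p+a≡F = begin
    fib (suc j) + b + a    ≡⟨ +-assoc (fib (suc j)) b a ⟩
    fib (suc j) + (b + a)  ≡⟨ cong (fib (suc j) +_) (trans (+-comm b a) (gap-eq br)) ⟩
    fib (suc (suc j))      ∎
  deficit′ : deficit j p ≡ a
  deficit′ = +-cancelˡ-≡ p _ _ (trans (deficit-eq br′) (sym p+a≡F))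

-- (C) at a given level.  If a < b then a + b = F_j makes a a smaller neighbour of b = p(w),
-- and (E) applies; if b < a then parent-swaps applies.
second-at : ∀ {j w} → Bracket j w →
            1 ≤ proj₂ (choose j w) → proj₂ (choose j w) ≢ proj₁ (choose j w) →
            proj₂ (choose j w) ≡ parent (proj₁ (choose j w)) ⊎
            proj₂ (choose j w) ≡ second (proj₁ (choose j w))
second-at {j} {w} br with choose j w | shape j w
... | _ | low a≤b  = λ 1≤a a≢b → neighbour j 1≤a (≤∧≢⇒< a≤b a≢b) (gap-eq br)
... | _ | high b<a = λ _ _ → inj₂ (sym (parent-swaps br b<a))

second-closure : ∀ w → 1 ≤ w → 1 ≤ second w → second w ≢ parent w →
                 second w ≡ parent (parent w) ⊎ second w ≡ second (parent w)
second-closure w 1≤w = second-at (level-bracket w 1≤w)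

final : ∀ {A : Set} → A → List A → A
final a []      = a
final a (b ∷ l) = final b l

final-∈ : ∀ {A : Set} (a : A) l → final a l ∈ˡ (a ∷ l)
final-∈ a []      = here refl
final-∈ a (b ∷ l) = there (final-∈ b l)

linked-last : ∀ {A : Set} {R : A → A → Set} a l z → Linked R (a ∷ l ++ z ∷ []) → R (final a l) z
linked-last a []      z (r ∷ _)  = r
linked-last a (b ∷ l) z (_ ∷ rs) = linked-last b l z rs

data Backtracks {A : Set} : List A → Set where
  back  : ∀ {x y l} → Backtracks (x ∷ y ∷ x ∷ l)
  later : ∀ {x l} → Backtracks l → Backtracks (x ∷ l)

unique-no-backtrack : ∀ {A : Set} {l : List A} → Unique l → ¬ Backtracks l
unique-no-backtrack ((_ ∷ x≢x ∷ _) ∷ _) back      = x≢x refl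
unique-no-backtrack (_ ∷ u)              (later b) = unique-no-backtrack u b

cycle-no-backtrack : ∀ {A : Set} {x₀ x₁ x₂ : A} {xs} → Unique (x₀ ∷ x₁ ∷ x₂ ∷ xs) →
                     ¬ Backtracks (x₀ ∷ x₁ ∷ x₂ ∷ xs ++ x₀ ∷ [])
cycle-no-backtrack ((_ ∷ x₀≢x₀ ∷ _) ∷ _) back      = x₀≢x₀ refl
cycle-no-backtrack (fresh ∷ u)            (later b) =
  unique-no-backtrack (++⁺ u ([] ∷ []) (All.map (λ x₀≢y → (x₀≢y ∘ sym) ∷ []) fresh)) b

module ParentTree (N : ℕ) (P : ℕ → ℕ) (P-below : ∀ i → 1 ≤ i → P i < i) where

  IsParent : Fin N → Fin N → Set
  IsParent a b = toℕ b ≡ P (toℕ a) × toℕ b < toℕ a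

  Edge : Fin N → Fin N → Set
  Edge a b = IsParent a b ⊎ IsParent b a

  Edge-sym : ∀ {a b} → Edge a b → Edge b a
  Edge-sym (inj₁ a↑b) = inj₂ a↑b
  Edge-sym (inj₂ b↑a) = inj₁ b↑a

  Edge-irrefl : ∀ {a} → ¬ Edge a a
  Edge-irrefl (inj₁ (_ , a<a)) = <-irrefl refl a<a
  Edge-irrefl (inj₂ (_ , a<a)) = <-irrefl refl a<a

  parent-unique : ∀ {a b c} → IsParent a b → IsParent a c → b ≡ c
  parent-unique (b≡ , _) (c≡ , _) = toℕ-injective (trans b≡ (sym c≡))

  parentOf : (t : Fin N) → 1 ≤ toℕ t → ∃ (IsParent t)
  parentOf t 1≤t = fromℕ< P<N , toℕ-fromℕ< P<N , subst (_< toℕ t) (sym (toℕ-fromℕ< P<N)) (P-below _ 1≤t)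
    where
    P<N : P (toℕ t) < N
    P<N = <-trans (P-below _ 1≤t) (toℕ<n t)

  toRoot : ∀ k (t r : Fin N) → toℕ r ≡ 0 → toℕ t < k → Star Edge t r
  toRoot (suc k) t r r≡0 (s≤s t≤k) with toℕ t ≟ 0
  ... | yes t≡0 = subst (λ x → Star Edge x r) (toℕ-injective (trans r≡0 (sym t≡0))) ε
  ... | no  t≢0 with parentOf t (n≢0⇒n>0 t≢0)
  ...   | p , t↑p = inj₁ t↑p ◅ toRoot k p r r≡0 (<-≤-trans (proj₂ t↑p) t≤k)

  connected′ : ∀ a b → Star Edge a b
  connected′ a b = toRoot _ a r r≡0 ≤-refl ◅◅ Star.reverse Edge-sym (toRoot _ b r r≡0 ≤-refl)
    where
    0<N : 0 < N
    0<N = ≤-<-trans z≤n (toℕ<n a)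
    r : Fin N
    r = fromℕ< 0<N
    r≡0 : toℕ r ≡ 0
    r≡0 = toℕ-fromℕ< 0<N

  Descends : Fin N → Fin N → Set
  Descends a b = IsParent b a

  data Peak : List (Fin N) → Set where
    descending : ∀ {l} → Linked Descends l → Peak l
    climb      : ∀ {a b l} → IsParent a b → Peak (b ∷ l) → Peak (a ∷ b ∷ l)

  -- A walk without backtracking is peaked: after a descent, climbing means returning to
  -- the unique parent just left.
  peak : ∀ l → Linked Edge l → ¬ Backtracks l → Peak l
  peak []          _        _  = descending []
  peak (a ∷ [])    _        _  = descending [-]
  peak (a ∷ b ∷ l) (e ∷ es) nb with peak (b ∷ l) es (nb ∘ later) | e
  ... | pk            | inj₁ a↑b = climb a↑b pk
  ... | descending ds | inj₂ b↑a = descending (b↑a ∷ ds)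
  ... | climb b↑c _   | inj₂ b↑a with parent-unique b↑a b↑c
  ...   | refl = ⊥-elim (nb back)

  descending-increases : ∀ a l z → Linked Descends (a ∷ l ++ z ∷ []) → toℕ a < toℕ z
  descending-increases a []      z (b↑a ∷ _)  = proj₂ b↑a
  descending-increases a (b ∷ l) z (b↑a ∷ ds) = <-trans (proj₂ b↑a) (descending-increases b l z ds)

  peak-last : ∀ a l z → Peak (a ∷ l ++ z ∷ []) → toℕ a < toℕ z → Descends (final a l) z
  peak-last a []      z (descending ds) _   = linked-last a [] z ds
  peak-last a []      z (climb a↑z _)   a<z = ⊥-elim (<-asym (proj₂ a↑z) a<z)
  peak-last a (b ∷ l) z (descending ds) _   = linked-last a (b ∷ l) z ds
  peak-last a (b ∷ l) z (climb a↑b pk)  a<z = peak-last b l z pk (<-trans (proj₂ a↑b) a<z)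

  -- Around a cycle x₀ x₁ … x₀ the walk is peaked; it cannot only descend, so it leaves
  -- x₀ to its parent x₁ and returns from it, making the last vertex equal to x₁.
  acyclic′ : ∀ cs → ¬ IsCycle Edge cs
  acyclic′ []           (() , _)
  acyclic′ (_ ∷ [])     (s≤s () , _)
  acyclic′ (_ ∷ _ ∷ []) (s≤s (s≤s ()) , _)
  acyclic′ (x₀ ∷ x₁ ∷ x₂ ∷ xs) (_ , u@(_ ∷ fresh₁ ∷ _) , es) with peak _ es (cycle-no-backtrack u)
  ... | descending ds = <-irrefl refl (descending-increases x₀ (x₁ ∷ x₂ ∷ xs) x₀ ds)
  ... | climb x₀↑x₁ pk = All.lookup fresh₁ (final-∈ x₂ xs)
          (parent-unique x₀↑x₁ (peak-last x₁ (x₂ ∷ xs) x₀ pk (proj₂ x₀↑x₁)))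

  parentTree : Tree
  parentTree = record
    { m = N ; E = Edge ; E-sym = Edge-sym ; E-irrefl = Edge-irrefl
    ; connected = connected′ ; acyclic = acyclic′ }

-- Vertex sets given by values: valueSet n v holds the vertex of Fin n with value
-- (index + 1) equal to v, and nothing when there is none.

valueSet : (n : ℕ) → ℕ → Subset n
valueSet zero    _             = []
valueSet (suc n) zero          = false ∷ valueSet n zero
valueSet (suc n) (suc zero)    = true  ∷ valueSet n zero
valueSet (suc n) (suc (suc v)) = false ∷ valueSet n (suc v)

∈valueSet : ∀ {n} (j : Fin n) → j ∈ valueSet n (suc (toℕ j))
∈valueSet Fin.zero    = here
∈valueSet (Fin.suc j) = there (∈valueSet j)

∉valueSet-0 : ∀ {n} (j : Fin n) → j ∉ valueSet n 0
∉valueSet-0 (Fin.suc j) (there j∈) = ∉valueSet-0 j j∈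

valueSet-∈ : ∀ {n} v (j : Fin n) → j ∈ valueSet n v → suc (toℕ j) ≡ v
valueSet-∈ zero          j           j∈         = ⊥-elim (∉valueSet-0 j j∈)
valueSet-∈ (suc zero)    Fin.zero    here       = refl
valueSet-∈ (suc zero)    (Fin.suc j) (there j∈) = ⊥-elim (∉valueSet-0 j j∈)
valueSet-∈ (suc (suc v)) (Fin.suc j) (there j∈) = cong suc (valueSet-∈ (suc v) j j∈)

∣valueSet-0∣ : ∀ n → ∣ valueSet n 0 ∣ ≡ 0
∣valueSet-0∣ zero    = refl
∣valueSet-0∣ (suc n) = ∣valueSet-0∣ n

∣valueSet∣≤1 : ∀ n v → ∣ valueSet n v ∣ ≤ 1
∣valueSet∣≤1 zero    _             = z≤n
∣valueSet∣≤1 (suc n) zero          = ∣valueSet∣≤1 n zero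
∣valueSet∣≤1 (suc n) (suc zero)    = s≤s (≤-reflexive (∣valueSet-0∣ n))
∣valueSet∣≤1 (suc n) (suc (suc v)) = ∣valueSet∣≤1 n (suc v)

∣p∪q∣≤∣p∣+∣q∣ : ∀ {n} (p q : Subset n) → ∣ p ∪ q ∣ ≤ ∣ p ∣ + ∣ q ∣
∣p∪q∣≤∣p∣+∣q∣ []          []          = z≤n
∣p∪q∣≤∣p∣+∣q∣ (true ∷ p)  (true ∷ q)  = s≤s (≤-trans (∣p∪q∣≤∣p∣+∣q∣ p q) (+-monoʳ-≤ ∣ p ∣ (n≤1+n _)))
∣p∪q∣≤∣p∣+∣q∣ (true ∷ p)  (false ∷ q) = s≤s (∣p∪q∣≤∣p∣+∣q∣ p q)
∣p∪q∣≤∣p∣+∣q∣ (false ∷ p) (true ∷ q)  = ≤-trans (s≤s (∣p∪q∣≤∣p∣+∣q∣ p q)) (≤-reflexive (sym (+-suc _ _)))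
∣p∪q∣≤∣p∣+∣q∣ (false ∷ p) (false ∷ q) = ∣p∪q∣≤∣p∣+∣q∣ p q

module UpperBound (N : ℕ) where

  val : Fin N → ℕ
  val t = suc (toℕ t)

  val-injective : ∀ {a b} → val a ≡ val b → a ≡ b
  val-injective = toℕ-injective ∘ suc-injective

  parentIndex : ℕ → ℕ
  parentIndex i = pred (parent (suc i))

  parentIndex-below : ∀ i → 1 ≤ i → parentIndex i < i
  parentIndex-below (suc i) _ =
    s≤s (pred-mono-≤ (≤-pred (proj₂ (parent-below (suc (suc i)) (s≤s (s≤s z≤n))))))

  open ParentTree N parentIndex parentIndex-below

  parent-value : ∀ {t p} → IsParent t p → val p ≡ parent (val t)
  parent-value {t} (p≡ , p<t) with toℕ t
  ... | suc i = trans (cong suc p≡)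
                  (suc-pred _ {{>-nonZero (proj₁ (parent-below (suc (suc i)) (s≤s (s≤s z≤n))))}})

  InBag : Fin N → Fin N → Set
  InBag u t = val u ≡ val t ⊎ val u ≡ parent (val t) ⊎ val u ≡ second (val t)

  bag′ : Fin N → Subset N
  bag′ t = valueSet N (val t) ∪ (valueSet N (parent (val t)) ∪ valueSet N (second (val t)))

  bag-in : ∀ {u t} → InBag u t → u ∈ bag′ t
  bag-in {u} (inj₁ e)        = x∈p∪q⁺ (inj₁ (subst (λ v → u ∈ valueSet N v) e (∈valueSet u)))
  bag-in {u} (inj₂ (inj₁ e)) = x∈p∪q⁺ (inj₂ (x∈p∪q⁺ (inj₁ (subst (λ v → u ∈ valueSet N v) e (∈valueSet u)))))
  bag-in {u} (inj₂ (inj₂ e)) = x∈p∪q⁺ (inj₂ (x∈p∪q⁺ (inj₂ (subst (λ v → u ∈ valueSet N v) e (∈valueSet u)))))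

  bag-out : ∀ {u t} → u ∈ bag′ t → InBag u t
  bag-out {u} {t} u∈ with x∈p∪q⁻ (valueSet N (val t)) _ u∈
  ... | inj₁ u∈t = inj₁ (valueSet-∈ _ u u∈t)
  ... | inj₂ u∈ps with x∈p∪q⁻ (valueSet N (parent (val t))) _ u∈ps
  ...   | inj₁ u∈p = inj₂ (inj₁ (valueSet-∈ _ u u∈p))
  ...   | inj₂ u∈s = inj₂ (inj₂ (valueSet-∈ _ u u∈s))

  bag-size : ∀ t → ∣ bag′ t ∣ ≤ 3
  bag-size t = ≤-trans (∣p∪q∣≤∣p∣+∣q∣ (valueSet N (val t)) _)
    (+-mono-≤ (∣valueSet∣≤1 N _) (≤-trans (∣p∪q∣≤∣p∣+∣q∣ (valueSet N (parent (val t))) _)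
      (+-mono-≤ (∣valueSet∣≤1 N _) (∣valueSet∣≤1 N _))))

  -- The bag of the root (value 1) is {1}, since p(1) = 1 and s(1) = 0.
  root-bag : ∀ {u t} → toℕ t ≡ 0 → u ∈ bag′ t → u ≡ t
  root-bag {u} {t} t≡0 u∈ with bag-out u∈
  ... | inj₁ e        = val-injective e
  ... | inj₂ (inj₁ e) = val-injective (trans e (trans (cong parent t≡1) (sym t≡1)))
    where
    t≡1 : val t ≡ 1
    t≡1 = cong suc t≡0
  ... | inj₂ (inj₂ e) = ⊥-elim (1+n≢0 (trans e (cong second (cong suc t≡0))))

  bag-climbs : ∀ {v t p} → IsParent t p → v ∈ bag′ t → v ≢ t → v ∈ bag′ p
  bag-climbs {v} {t} {p} t↑p v∈t v≢t with bag-out v∈t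
  ... | inj₁ e        = ⊥-elim (v≢t (val-injective e))
  ... | inj₂ (inj₁ e) = bag-in (inj₁ (trans e (sym (parent-value t↑p))))
  ... | inj₂ (inj₂ e) with second (val t) ≟ parent (val t)
  ...   | yes s≡p = bag-in (inj₁ (trans e (trans s≡p (sym (parent-value t↑p)))))
  ...   | no  s≢p with second-closure (val t) (s≤s z≤n) (subst (1 ≤_) e (s≤s z≤n)) s≢p
  ...     | inj₁ s≡pp = bag-in (inj₂ (inj₁ (trans e (trans s≡pp (cong parent (sym (parent-value t↑p)))))))
  ...     | inj₂ s≡sp = bag-in (inj₂ (inj₂ (trans e (trans s≡sp (cong second (sym (parent-value t↑p)))))))

  Keeps : Fin N → Fin N → Fin N → Set
  Keeps v a b = Edge a b × v ∈ bag′ a × v ∈ bag′ b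

  Keeps-sym : ∀ {v a b} → Keeps v a b → Keeps v b a
  Keeps-sym (e , v∈a , v∈b) = Edge-sym e , v∈b , v∈a

  climb-to : ∀ k v t → toℕ t < k → v ∈ bag′ t → Star (Keeps v) t v
  climb-to (suc k) v t (s≤s t≤k) v∈t with t ≟ᶠ v
  ... | yes refl = ε
  ... | no  t≢v with toℕ t ≟ 0
  ...   | yes t≡0 = ⊥-elim (t≢v (sym (root-bag t≡0 v∈t)))
  ...   | no  t≢0 with parentOf t (n≢0⇒n>0 t≢0)
  ...     | p , t↑p = (inj₁ t↑p , v∈t , v∈p) ◅ climb-to k v p (<-≤-trans (proj₂ t↑p) t≤k) v∈p
    where
    v∈p : v ∈ bag′ p
    v∈p = bag-climbs t↑p v∈t (t≢v ∘ sym)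

  smaller-end-in-bag : ∀ {u v} → toℕ u < toℕ v → IsFib (val u + val v) → u ∈ bag′ v
  smaller-end-in-bag u<v (m , eq) = bag-in (inj₂ (neighbour m (s≤s z≤n) (s≤s u<v) (sym eq)))

  decomposition : TreeDecomposition (fibSumGraph N)
  decomposition = record
    { tree     = parentTree
    ; bag      = bag′
    ; covers   = λ v → v , bag-in (inj₁ refl)
    ; edges    = edges′
    ; coherent = λ v t t′ v∈t v∈t′ →
        climb-to _ v t ≤-refl v∈t ◅◅ Star.reverse Keeps-sym (climb-to _ v t′ ≤-refl v∈t′)
    }
    where
    edges′ : ∀ u v → FibAdj N u v → ∃ λ t → u ∈ bag′ t × v ∈ bag′ t
    edges′ u v (u≢v , fib-sum) with <-cmp (toℕ u) (toℕ v)
    ... | tri≈ _ u≡v _ = ⊥-elim (u≢v (toℕ-injective u≡v))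
    ... | tri< u<v _ _ = v , smaller-end-in-bag u<v fib-sum , bag-in (inj₁ refl)
    ... | tri> _ _ v<u = u , bag-in (inj₁ refl) ,
        smaller-end-in-bag v<u (proj₁ fib-sum , trans (proj₂ fib-sum) (+-comm (val u) (val v)))

fibSumGraph-width≤2 : ∀ N → HasTreeDecompositionOfWidth≤ (fibSumGraph N) 2
fibSumGraph-width≤2 N = decomposition , bag-size
  where open UpperBound N

module Walks {V : Set} (_≟ᵛ_ : DecidableEquality V) where

  walk-list : ∀ {R : V → V → Set} {a b} → Star R a b → ∃ λ l → Linked R (a ∷ l) × final a l ≡ b
  walk-list ε        = [] , [-] , refl
  walk-list (r ◅ rs) with walk-list rs
  ... | l , rs′ , end = _ ∷ l , r ∷ rs′ , end

  after : ∀ {a : V} xs → a ∈ˡ xs → List V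
  after (_ ∷ xs) (here _)  = xs
  after (_ ∷ xs) (there i) = after xs i

  linked-after : ∀ {R : V → V → Set} {a} c xs (i : a ∈ˡ c ∷ xs) →
                 Linked R (c ∷ xs) → Linked R (a ∷ after (c ∷ xs) i)
  linked-after c xs       (here refl) rs       = rs
  linked-after c (d ∷ xs) (there i)   (_ ∷ rs) = linked-after d xs i rs

  final-after : ∀ {a} c xs (i : a ∈ˡ c ∷ xs) → final a (after (c ∷ xs) i) ≡ final c xs
  final-after c xs       (here refl) = refl
  final-after c (d ∷ xs) (there i)   = final-after d xs i

  unique-after : ∀ {a} c xs (i : a ∈ˡ c ∷ xs) → Unique (c ∷ xs) → Unique (a ∷ after (c ∷ xs) i)
  unique-after c xs       (here refl) u       = u
  unique-after c (d ∷ xs) (there i)   (_ ∷ u) = unique-after d xs i u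

  loop-erase : ∀ {R : V → V → Set} a l → Linked R (a ∷ l) →
               ∃ λ l′ → Linked R (a ∷ l′) × final a l′ ≡ final a l × Unique (a ∷ l′)
  loop-erase a []      _        = [] , [-] , refl , [] ∷ []
  loop-erase a (b ∷ l) (r ∷ rs) with loop-erase b l rs
  ... | l′ , rs′ , end , u with any? (a ≟ᵛ_) (b ∷ l′)
  ...   | yes i  = after (b ∷ l′) i , linked-after b l′ i rs′ , trans (final-after b l′ i) end ,
                   unique-after b l′ i u
  ...   | no  a∉ = b ∷ l′ , r ∷ rs′ , end , ¬Any⇒All¬ _ a∉ ∷ u

  linked-snoc : ∀ {R : V → V → Set} a l z → Linked R (a ∷ l) → R (final a l) z →
                Linked R (a ∷ l ++ z ∷ [])
  linked-snoc a []      z _        r  = r ∷ [-]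
  linked-snoc a (b ∷ l) z (r ∷ rs) r′ = r ∷ linked-snoc b l z rs r′

  avoiding : ∀ {R : V → V → Set} {x} c l → Linked R (c ∷ l) → All (x ≢_) l →
             Star (λ u w → R u w × w ≢ x) c (final c l)
  avoiding c []      _        _            = ε
  avoiding c (d ∷ l) (r ∷ rs) (x≢d ∷ x≢ds) = (r , x≢d ∘ sym) ◅ avoiding d l rs x≢ds

  record Exit (R : V → V → Set) (P : V → Set) (a : V) (l : List V) : Set where
    field
      x y    : V
      step   : R x y
      inside : P x
      out    : ¬ P y
      y∈     : y ∈ˡ l
      before : Star (λ u w → R u w × u ≢ y) a x
      beyond : Star (λ u w → R u w × w ≢ x) y (final a l)

  exit : ∀ {R : V → V → Set} {P : V → Set} → (∀ v → Dec (P v)) → ∀ a l → Linked R (a ∷ l) →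
         Unique (a ∷ l) → P a → ¬ P (final a l) → Exit R P a l
  exit P? a []      _        _        Pa ¬Pend = ⊥-elim (¬Pend Pa)
  exit P? a (b ∷ l) (r ∷ rs) (a∉ ∷ u) Pa ¬Pend with P? b
  ... | no ¬Pb = record
    { x = a ; y = b ; step = r ; inside = Pa ; out = ¬Pb ; y∈ = here refl
    ; before = ε ; beyond = avoiding b l rs (All.tail a∉) }
  ... | yes Pb = record
    { x = x ; y = y ; step = step ; inside = inside ; out = out ; y∈ = there y∈
    ; before = (r , All.lookup a∉ (there y∈)) ◅ before ; beyond = beyond }
    where open Exit (exit P? b l rs u Pb ¬Pend)

-- In a tree every walk from y back to a neighbour x takes the step y → x: otherwise
-- loop erasure and the edge x y would close a cycle.
module _ (T : Tree) where
  open Walks (_≟ᶠ_ {m T})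

  no-detour : ∀ {x y} → E T x y → Star (λ a b → E T a b × ¬ (a ≡ y × b ≡ x)) y x → ⊥
  no-detour {x} {y} x~y detour with walk-list detour
  ... | l , rs , end with loop-erase y l rs
  ... | [] , _ , end′ , _ = E-irrefl T (subst (λ z → E T z y) (sym (trans end′ end)) x~y)
  ... | b ∷ [] , (r ∷ _) , end′ , _ = proj₂ r (refl , trans end′ end)
  ... | b ∷ c ∷ l′ , rs′ , end′ , u = acyclic T (y ∷ b ∷ c ∷ l′)
    (s≤s (s≤s (s≤s z≤n)) , u , linked-snoc y (b ∷ c ∷ l′) y (Linked.map proj₁ rs′)
                                  (subst (λ z → E T z y) (sym (trans end′ end)) x~y))

pair-bag : ∀ {k} {p : Subset k} {a b c} → ∣ p ∣ ≤ 2 → a ∈ p → b ∈ p → a ≢ b → c ∈ p → c ≡ a ⊎ c ≡ b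
pair-bag {p = p} {a} {b} {c} ∣p∣≤2 a∈ b∈ a≢b c∈ with c ≟ᶠ a | c ≟ᶠ b
... | yes c≡a | _       = inj₁ c≡a
... | no  _   | yes c≡b = inj₂ c≡b
... | no  c≢a | no  c≢b = ⊥-elim (<⇒≱ 2<∣p∣ ∣p∣≤2)
  where
  b∈p-a : b ∈ p - a
  b∈p-a = x∈p∧x≢y⇒x∈p-y b∈ (a≢b ∘ sym)
  c∈p-a-b : c ∈ p - a - b
  c∈p-a-b = x∈p∧x≢y⇒x∈p-y (x∈p∧x≢y⇒x∈p-y c∈ c≢a) c≢b
  2<∣p∣ : 2 < ∣ p ∣
  2<∣p∣ = ≤-<-trans (≤-<-trans (≤-<-trans z≤n (x∈p⇒∣p-x∣<∣p∣ c∈p-a-b)) (x∈p⇒∣p-x∣<∣p∣ b∈p-a))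
                    (x∈p⇒∣p-x∣<∣p∣ a∈)

-- A graph containing a 4-cycle a b c d has no tree decomposition with bags of size ≤ 2.
-- The subtree of b joins the nodes hosting ab and bc; on a simple path between them let
-- x → y be the step where a is lost, so the bag of x is {a, b}.  The subtrees of c, d
-- and a then lead from y back to x without stepping from y to x, against no-detour.
four-cycle⇒width>1 : (G : Graph) (a b c d : Fin (n G)) → a ≢ b → a ≢ c → a ≢ d → b ≢ c → b ≢ d →
                     Adj G a b → Adj G b c → Adj G c d → Adj G d a →
                     (D : TreeDecomposition G) → ¬ (∀ t → ∣ bag D t ∣ ≤ 2)
four-cycle⇒width>1 G a b c d a≢b a≢c a≢d b≢c b≢d ab bc cd da D small =
  no-detour T (proj₁ step) (y⇝bc ◅◅ within-missing-x c≢a c≢b c-subtree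
                               ◅◅ within-missing-x d≢a d≢b d-subtree ◅◅ within-a a-subtree ◅◅ ab⇝x)
  where
  T : Tree
  T = tree D
  B : Fin (m T) → Subset (n G)
  B = bag D
  open Walks (_≟ᶠ_ {m T})

  Within : Fin (n G) → Fin (m T) → Fin (m T) → Set
  Within z u w = E T u w × z ∈ B u × z ∈ B w

  t-ab t-bc t-cd t-da : Fin (m T)
  t-ab = proj₁ (edges D a b ab)
  t-bc = proj₁ (edges D b c bc)
  t-cd = proj₁ (edges D c d cd)
  t-da = proj₁ (edges D d a da)

  a∈ab : a ∈ B t-ab
  b∈ab : b ∈ B t-ab
  b∈bc : b ∈ B t-bc
  c∈bc : c ∈ B t-bc
  c∈cd : c ∈ B t-cd
  d∈cd : d ∈ B t-cd
  d∈da : d ∈ B t-da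
  a∈da : a ∈ B t-da
  a∈ab = proj₁ (proj₂ (edges D a b ab))
  b∈ab = proj₂ (proj₂ (edges D a b ab))
  b∈bc = proj₁ (proj₂ (edges D b c bc))
  c∈bc = proj₂ (proj₂ (edges D b c bc))
  c∈cd = proj₁ (proj₂ (edges D c d cd))
  d∈cd = proj₂ (proj₂ (edges D c d cd))
  d∈da = proj₁ (proj₂ (edges D d a da))
  a∈da = proj₂ (proj₂ (edges D d a da))

  c≢a : c ≢ a
  c≢b : c ≢ b
  d≢a : d ≢ a
  d≢b : d ≢ b
  c≢a = a≢c ∘ sym
  c≢b = b≢c ∘ sym
  d≢a = a≢d ∘ sym
  d≢b = b≢d ∘ sym

  b-walk : ∃ λ l → Linked (Within b) (t-ab ∷ l) × final t-ab l ≡ t-bc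
  b-walk = walk-list (coherent D b t-ab t-bc b∈ab b∈bc)
  b-path : ∃ λ l → Linked (Within b) (t-ab ∷ l) × final t-ab l ≡ final t-ab (proj₁ b-walk) ×
                   Unique (t-ab ∷ l)
  b-path = loop-erase t-ab (proj₁ b-walk) (proj₁ (proj₂ b-walk))

  b-end : final t-ab (proj₁ b-path) ≡ t-bc
  b-end = trans (proj₁ (proj₂ (proj₂ b-path))) (proj₂ (proj₂ b-walk))

  a∉bc : ¬ a ∈ B (final t-ab (proj₁ b-path))
  a∉bc a∈ with pair-bag (small t-bc) b∈bc c∈bc b≢c (subst (λ t → a ∈ B t) b-end a∈)
  ... | inj₁ a≡b = a≢b a≡b
  ... | inj₂ a≡c = a≢c a≡c

  open Exit (exit (λ t → a ∈? B t) t-ab (proj₁ b-path) (proj₁ (proj₂ b-path))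
                  (proj₂ (proj₂ (proj₂ b-path))) a∈ab a∉bc)

  only-a-b : ∀ {z} → z ≢ a → z ≢ b → ¬ z ∈ B x
  only-a-b z≢a z≢b z∈x with pair-bag (small x) inside (proj₁ (proj₂ step)) a≢b z∈x
  ... | inj₁ z≡a = z≢a z≡a
  ... | inj₂ z≡b = z≢b z≡b

  NotBack : Fin (m T) → Fin (m T) → Set
  NotBack u w = E T u w × ¬ (u ≡ y × w ≡ x)

  within-missing-x : ∀ {z s t} → z ≢ a → z ≢ b → Star (Within z) s t → Star NotBack s t
  within-missing-x {z} z≢a z≢b = Star.map λ { (e , _ , z∈w) →
    e , λ { (_ , w≡x) → only-a-b z≢a z≢b (subst (λ t → z ∈ B t) w≡x z∈w) } }

  within-a : ∀ {s t} → Star (Within a) s t → Star NotBack s t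
  within-a = Star.map λ { (e , a∈u , _) → e , λ { (u≡y , _) → out (subst (λ t → a ∈ B t) u≡y a∈u) } }

  c-subtree : Star (Within c) t-bc t-cd
  d-subtree : Star (Within d) t-cd t-da
  a-subtree : Star (Within a) t-da t-ab
  c-subtree = coherent D c t-bc t-cd c∈bc c∈cd
  d-subtree = coherent D d t-cd t-da d∈cd d∈da
  a-subtree = coherent D a t-da t-ab a∈da a∈ab

  y⇝bc : Star NotBack y t-bc
  y⇝bc = subst (Star NotBack y) b-end
    (Star.map (λ { ((e , _) , w≢x) → e , λ { (_ , w≡x) → w≢x w≡x } }) beyond)

  ab⇝x : Star NotBack t-ab x
  ab⇝x = Star.map (λ { ((e , _) , u≢y) → e , λ { (u≡y , _) → u≢y u≡y } }) before

-- The 4-cycle 1 – 2 – 6 – 7 – 1 of G_n (edge sums 3, 8, 13, 8) rules out width ≤ 1.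
no-width-one : ∀ k j → j < 2 → ¬ HasTreeDecompositionOfWidth≤ (fibSumGraph (7 + k)) j
no-width-one k j j<2 (D , width≤j) =
  four-cycle⇒width>1 (fibSumGraph (7 + k)) (# 0) (# 1) (# 5) (# 6)
    (λ ()) (λ ()) (λ ()) (λ ()) (λ ())
    ((λ ()) , 4 , refl) ((λ ()) , 6 , refl) ((λ ()) , 7 , refl) ((λ ()) , 6 , refl)
    D (λ t → ≤-trans (width≤j t) j<2)

theorem12 : (n : ℕ) → 7 ≤ n → Treewidth (fibSumGraph n) 2
theorem12 n 7≤n with m≤n⇒∃[o]m+o≡n 7≤n
... | k , refl = fibSumGraph-width≤2 (7 + k) , no-width-one k
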